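{- Let $G$ be a simple graph on $n$ vertices with adjacency matrix $A$ and walk-matrix $W=[e,Ae,\dots,A^{n-1}e]$ ($e$ the all-one vector), and let $p$ be a prime with $\mathrm{rank}_p(W)=n-1$. Let $z$ be an integral vector with $W^Tz\equiv 0\pmod p$ and $z\not\equiv 0\pmod p$. If there exists an integral vector $x$ such that $W^Tx\equiv \frac{W^Tz}{p}\pmod p$, then $p^2\mid\det(W)$.
   Context: $\mathrm{rank}_p(M)$ denotes the rank of an integral matrix $M$ over $\mathbf{F}_p$. Congruences of vectors are entrywise. -}

module Defs where

open import Data.Nat.Base as ℕ using (ℕ; zero; suc)
open import Data.Nat.Primality using (Prime; prime⇒nonZero)
open import Data.Fin.Base using (Fin; zero; suc; toℕ; punchIn)
open import Data.Integer.Base using (ℤ; +_; _+_; _-_; _*_; -_; 0ℤ; 1ℤ; _/ℕ_)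
open import Data.Integer.Divisibility using (_∣_)
open import Data.Bool.Base using (Bool; true; false; if_then_else_)
open import Data.Product.Base using (Σ; _×_)
open import Relation.Binary.PropositionalEquality using (_≡_)
open import Relation.Nullary using (¬_)

Vector : ℕ → Set
Vector n = Fin n → ℤ

Matrix : ℕ → Set
Matrix n = Fin n → Fin n → ℤ

sumF : ∀ {n} → (Fin n → ℤ) → ℤ
sumF {zero}  f = 0ℤ
sumF {suc n} f = f zero + sumF (λ i → f (suc i))

transpose : ∀ {n} → Matrix n → Matrix n
transpose M i j = M j i

_·_ : ∀ {n} → Matrix n → Vector n → Vector n
(M · v) i = sumF (λ j → M i j * v j)

ones : ∀ {n} → Vector n
ones _ = 1ℤ

record SimpleGraph (n : ℕ) : Set where
  field
    adj    : Fin n → Fin n → Bool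
    symm   : ∀ i j → adj i j ≡ adj j i
    irrefl : ∀ i → adj i i ≡ false

adjacencyMatrix : ∀ {n} → SimpleGraph n → Matrix n
adjacencyMatrix G i j = if SimpleGraph.adj G i j then 1ℤ else 0ℤ

walkVec : ∀ {n} → Matrix n → ℕ → Vector n
walkVec A zero    = ones
walkVec A (suc k) = A · walkVec A k

walkMatrix : ∀ {n} → SimpleGraph n → Matrix n
walkMatrix G i j = walkVec (adjacencyMatrix G) (toℕ j) i

signℤ : ℕ → ℤ
signℤ zero          = 1ℤ
signℤ (suc zero)    = - 1ℤ
signℤ (suc (suc k)) = signℤ k

det : ∀ {n} → Matrix n → ℤ
det {zero}  M = 1ℤ
det {suc n} M =
  sumF (λ j → signℤ (toℕ j) * M zero j * det (λ i k → M (suc i) (punchIn j k)))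

_≡_[mod_] : ℤ → ℤ → ℕ → Set
a ≡ b [mod p ] = (+ p) ∣ (a - b)

_≡ᵥ_[mod_] : ∀ {n} → Vector n → Vector n → ℕ → Set
u ≡ᵥ v [mod p ] = ∀ i → u i ≡ v i [mod p ]

zeroVec : ∀ {n} → Vector n
zeroVec _ = 0ℤ

-- exact division by a prime (used only on entries divisible by p)
divByPrime : ∀ {p} → Prime p → ℤ → ℤ
divByPrime {p} pp a = a /ℕ p
  where instance _ = prime⇒nonZero pp

vecDivByPrime : ∀ {n p} → Prime p → Vector n → Vector n
vecDivByPrime pp v i = divByPrime pp (v i)

-- the columns σ 0, ..., σ (r-1) of M are linearly independent over F_p
-- (coefficients in F_p represented by integer lifts)
ColumnsIndependentMod : ∀ {n r} → ℕ → Matrix n → (Fin r → Fin n) → Set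
ColumnsIndependentMod {n} {r} p M σ =
  (c : Fin r → ℤ) →
  (∀ i → sumF (λ k → c k * M i (σ k)) ≡ 0ℤ [mod p ]) →
  ∀ k → c k ≡ 0ℤ [mod p ]

RankMod : ∀ {n} → ℕ → Matrix n → ℕ → Set
RankMod {n} p M r =
  Σ (Fin r → Fin n) (λ σ → ColumnsIndependentMod p M σ) ×
  (∀ (τ : Fin (suc r) → Fin n) → ¬ ColumnsIndependentMod p M τ)

-- Put y = z - p x. Since W^T z = p (W^T z / p) and W^T x ≡ W^T z / p (mod p), we get
-- W^T y ≡ 0 (mod p²), while y ≢ 0 (mod p) because z ≢ 0. Choose k with p ∤ y_k. Replacing
-- row k of W by y^T W multiplies the determinant by y_k, and the new row is divisible by p²,
-- so p² ∣ y_k det W and hence p² ∣ det W.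
module Submission where

open import Defs
open import Data.Nat.Base using (ℕ; zero; suc; _∸_; _^_)
import Data.Nat.Base as ℕ
import Data.Nat.Properties as ℕ
import Data.Nat.Divisibility as ℕ
open import Data.Nat.Primality using (Prime; prime⇒nonZero; euclidsLemma)
open import Data.Fin.Base using (Fin; zero; suc; toℕ; punchIn; punchOut)
open import Data.Fin.Properties
  using (_≟_; suc-injective; punchInᵢ≢i; punchIn-punchOut; punchOut-cong; punchOut-punchIn; ¬∀⟶∃¬)
open import Data.Integer.Base using (ℤ; +_; -[1+_]; _+_; _-_; _*_; -_; 0ℤ; 1ℤ; ∣_∣; _/ℕ_; _%ℕ_)
open import Data.Integer.Properties
  using (*-zeroʳ; +-identityʳ; +-identityˡ; *-comm; *-distribˡ-+; neg-distrib-+; abs-*; pos-*)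
open import Data.Integer.DivMod using (a≡a%ℕn+[a/ℕn]*n)
open import Data.Integer.Divisibility using (_∣_)
import Data.Integer.Divisibility.Signed as Signed
open import Data.Integer.Tactic.RingSolver using (solve-∀)
open import Data.Vec.Functional using (updateAt)
open import Data.Vec.Functional.Properties
  using (updateAt-updates; updateAt-minimal; updateAt-id-local; updateAt-commutes; map-updateAt)
open import Data.Product.Base using (Σ; _,_; proj₁; proj₂)
open import Data.Sum.Base using (inj₁; inj₂)
open import Function.Base using (_∘_; const)
open import Relation.Nullary using (¬_; Dec; yes; no; contradiction)
open import Relation.Binary.PropositionalEquality

private
  variable
    m n : ℕ

sumF-cong : {f g : Fin n → ℤ} → f ≗ g → sumF f ≡ sumF g
sumF-cong {zero}  f≗g = refl
sumF-cong {suc n} f≗g = cong₂ _+_ (f≗g zero) (sumF-cong (f≗g ∘ suc))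

sumF-zero : {f : Fin n → ℤ} → (∀ i → f i ≡ 0ℤ) → sumF f ≡ 0ℤ
sumF-zero {zero}  f≡0 = refl
sumF-zero {suc n} f≡0 = cong₂ _+_ (f≡0 zero) (sumF-zero (f≡0 ∘ suc))

sumF-+ : (f g : Fin n → ℤ) → sumF (λ i → f i + g i) ≡ sumF f + sumF g
sumF-+ {zero}  f g = refl
sumF-+ {suc n} f g =
  trans (cong (_+_ (f zero + g zero)) (sumF-+ (f ∘ suc) (g ∘ suc)))
        (interchange (f zero) (g zero) (sumF (f ∘ suc)) (sumF (g ∘ suc)))
  where
  interchange : ∀ a b c d → a + b + (c + d) ≡ a + c + (b + d)
  interchange = solve-∀

sumF-*ˡ : (a : ℤ) (f : Fin n → ℤ) → sumF (λ i → a * f i) ≡ a * sumF f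
sumF-*ˡ {zero}  a f = sym (*-zeroʳ a)
sumF-*ˡ {suc n} a f =
  trans (cong (_+_ (a * f zero)) (sumF-*ˡ a (f ∘ suc))) (sym (*-distribˡ-+ a (f zero) _))

sumF-neg : (f : Fin n → ℤ) → sumF (λ i → - f i) ≡ - sumF f
sumF-neg {zero}  f = refl
sumF-neg {suc n} f =
  trans (cong (_+_ (- f zero)) (sumF-neg (f ∘ suc))) (sym (neg-distrib-+ (f zero) _))

sumF-comm : (f : Fin m → Fin n → ℤ) →
  sumF (λ a → sumF (λ b → f a b)) ≡ sumF (λ b → sumF (λ a → f a b))
sumF-comm {zero} {n} f = sym (sumF-zero {n} (λ _ → refl))
sumF-comm {suc m} f =
  trans (cong (_+_ (sumF (f zero))) (sumF-comm (f ∘ suc)))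
        (sym (sumF-+ (f zero) (λ b → sumF (λ a → f (suc a) b))))

sumF-single : (f : Fin n → ℤ) (i : Fin n) → (∀ j → j ≢ i → f j ≡ 0ℤ) → sumF f ≡ f i
sumF-single f zero    f≡0 =
  trans (cong (_+_ (f zero)) (sumF-zero (λ j → f≡0 (suc j) λ ()))) (+-identityʳ (f zero))
sumF-single f (suc i) f≡0 =
  trans (cong₂ _+_ (f≡0 zero λ ())
                   (sumF-single (f ∘ suc) i (λ j j≢i → f≡0 (suc j) (j≢i ∘ suc-injective))))
        (+-identityˡ (f (suc i)))

sumF-punchIn : (f : Fin (suc n) → ℤ) (i : Fin (suc n)) → f i ≡ 0ℤ →
  sumF f ≡ sumF (f ∘ punchIn i)
sumF-punchIn         f zero    fi≡0 = trans (cong (_+ sumF (f ∘ suc)) fi≡0) (+-identityˡ _)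
sumF-punchIn {suc n} f (suc i) fi≡0 = cong (_+_ (f zero)) (sumF-punchIn (f ∘ suc) i fi≡0)

i≡-i⇒i≡0 : ∀ i → i ≡ - i → i ≡ 0ℤ
i≡-i⇒i≡0 (+ zero)  _  = refl
i≡-i⇒i≡0 (+ suc n) ()
i≡-i⇒i≡0 -[1+ n ]  ()

quadratic-antisymmetric : (r : Fin n → ℤ) (c : Fin n → Fin n → ℤ) →
  (∀ a b → c a b ≡ - c b a) → sumF (λ a → r a * sumF (λ b → r b * c a b)) ≡ 0ℤ
quadratic-antisymmetric r c c-antisym = i≡-i⇒i≡0 _ (begin
  sumF (λ a → r a * sumF (λ b → r b * c a b))
    ≡⟨ sumF-cong (λ a → sym (sumF-*ˡ (r a) (λ b → r b * c a b))) ⟩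
  sumF (λ a → sumF (λ b → r a * (r b * c a b)))
    ≡⟨ sumF-comm (λ a b → r a * (r b * c a b)) ⟩
  sumF (λ b → sumF (λ a → r a * (r b * c a b)))
    ≡⟨ sumF-cong (λ b → sumF-cong (λ a → trans (cong (λ t → r a * (r b * t)) (c-antisym a b))
                                               (swap (r a) (r b) (c b a)))) ⟩
  sumF (λ b → sumF (λ a → - (r b * (r a * c b a))))
    ≡⟨ sumF-cong (λ b → trans (sumF-neg (λ a → r b * (r a * c b a)))
                              (cong -_ (sumF-*ˡ (r b) (λ a → r a * c b a)))) ⟩
  sumF (λ b → - (r b * sumF (λ a → r a * c b a)))
    ≡⟨ sumF-neg (λ b → r b * sumF (λ a → r a * c b a)) ⟩
  - sumF (λ b → r b * sumF (λ a → r a * c b a)) ∎)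
  where
  open ≡-Reasoning
  swap : ∀ x y t → x * (y * - t) ≡ - (y * (x * t))
  swap = solve-∀

infixl 6 _[_]≔_

_[_]≔_ : Matrix n → Fin n → Vector n → Matrix n
M [ k ]≔ v = updateAt M k (const v)

sign : Fin n → ℤ
sign j = signℤ (toℕ j)

minor : Matrix (suc n) → Fin (suc n) → Matrix n
minor M j i k = M (suc i) (punchIn j k)

det-cong : {M N : Matrix n} → (∀ i → M i ≗ N i) → det M ≡ det N
det-cong {zero}  M≗N = refl
det-cong {suc n} M≗N = sumF-cong (λ j →
  cong₂ (λ a d → sign j * a * d) (M≗N zero j) (det-cong (λ i k → M≗N (suc i) (punchIn j k))))

record IsLinear (F : Vector n → ℤ) : Set where
  field
    ≗-cong : ∀ {u v} → u ≗ v → F u ≡ F v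
    +-hom  : ∀ u v → F (λ i → u i + v i) ≡ F u + F v
    *-hom  : ∀ a u → F (λ i → a * u i) ≡ a * F u

open IsLinear

IsLinear-resp : {F H : Vector n → ℤ} → (∀ v → F v ≡ H v) → IsLinear H → IsLinear F
IsLinear-resp F≡H L = record
  { ≗-cong = λ {u} {v} u≗v → trans (F≡H u) (trans (≗-cong L u≗v) (sym (F≡H v)))
  ; +-hom  = λ u v → trans (F≡H _) (trans (+-hom L u v) (sym (cong₂ _+_ (F≡H u) (F≡H v))))
  ; *-hom  = λ a u → trans (F≡H _) (trans (*-hom L a u) (sym (cong (a *_) (F≡H u))))
  }

IsLinear-∘ : {F : Vector n → ℤ} → IsLinear F → (π : Fin n → Fin m) → IsLinear (λ v → F (v ∘ π))
IsLinear-∘ L π = record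
  { ≗-cong = λ u≗v → ≗-cong L (u≗v ∘ π)
  ; +-hom  = λ u v → +-hom L (u ∘ π) (v ∘ π)
  ; *-hom  = λ a u → *-hom L a (u ∘ π)
  }

IsLinear-combination : (c : Fin m → ℤ) {G : Fin m → Vector n → ℤ} → (∀ j → IsLinear (G j)) →
  IsLinear (λ v → sumF (λ j → c j * G j v))
IsLinear-combination c {G} L = record
  { ≗-cong = λ u≗v → sumF-cong (λ j → cong (c j *_) (≗-cong (L j) u≗v))
  ; +-hom  = λ u v → trans (sumF-cong (λ j → trans (cong (c j *_) (+-hom (L j) u v))
                                                   (*-distribˡ-+ (c j) (G j u) (G j v))))
                           (sumF-+ (λ j → c j * G j u) (λ j → c j * G j v))
  ; *-hom  = λ a u → trans (sumF-cong (λ j → trans (cong (c j *_) (*-hom (L j) a u))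
                                                   (*-left-comm (c j) a (G j u))))
                           (sumF-*ˡ a (λ j → c j * G j u))
  }
  where
  *-left-comm : ∀ x y t → x * (y * t) ≡ y * (x * t)
  *-left-comm = solve-∀

linear-sum : {F : Vector n → ℤ} → IsLinear F → (R : Fin m → Vector n) (y : Fin m → ℤ) →
  F (λ c → sumF (λ i → y i * R i c)) ≡ sumF (λ i → y i * F (R i))
linear-sum {m = zero}  L R y = *-hom L 0ℤ (λ _ → 0ℤ)
linear-sum {m = suc m} L R y =
  trans (+-hom L (λ c → y zero * R zero c) (λ c → sumF (λ i → y (suc i) * R (suc i) c)))
        (cong₂ _+_ (*-hom L (y zero) (R zero)) (linear-sum L (R ∘ suc) (y ∘ suc)))

minor-[]≔ : (M : Matrix (suc (suc n))) (k : Fin (suc n)) (v : Vector (suc (suc n)))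
  (j : Fin (suc (suc n))) → ∀ i → minor (M [ suc k ]≔ v) j i ≡ (minor M j [ k ]≔ (v ∘ punchIn j)) i
minor-[]≔ M k v j = map-updateAt {f = _∘ punchIn j} {g = const v} (λ _ → refl) (λ i → M (suc i)) k

det-linear : (M : Matrix n) (k : Fin n) → IsLinear (λ v → det (M [ k ]≔ v))
det-linear {suc n} M zero = record
  { ≗-cong = λ u≗v → sumF-cong (λ j → cong (λ t → sign j * t * det (minor M j)) (u≗v j))
  ; +-hom  = λ u v → trans (sumF-cong (λ j → distrib (sign j) (u j) (v j) (det (minor M j))))
                           (sumF-+ (λ j → sign j * u j * det (minor M j))
                                   (λ j → sign j * v j * det (minor M j)))
  ; *-hom  = λ a u → trans (sumF-cong (λ j → pull (sign j) a (u j) (det (minor M j))))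
                           (sumF-*ˡ a (λ j → sign j * u j * det (minor M j)))
  }
  where
  distrib : ∀ s x y d → s * (x + y) * d ≡ s * x * d + s * y * d
  distrib = solve-∀
  pull : ∀ s a x d → s * (a * x) * d ≡ a * (s * x * d)
  pull = solve-∀
det-linear {suc (suc n)} M (suc k) =
  IsLinear-resp
    (λ v → sumF-cong (λ j → cong (sign j * M zero j *_) (det-cong (λ i → cong-app (minor-[]≔ M k v j i)))))
    (IsLinear-combination (λ j → sign j * M zero j) (λ j → IsLinear-∘ (det-linear (minor M j) k) (punchIn j)))

sign-suc : ∀ k → signℤ (suc k) ≡ - signℤ k
sign-suc zero          = refl
sign-suc (suc zero)    = refl
sign-suc (suc (suc k)) = sign-suc k

-- punchSwap a b is the position of a once punchIn a b has been removed.
punchSwap : Fin (suc (suc n)) → Fin (suc n) → Fin (suc n)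
punchSwap zero    b       = zero
punchSwap (suc a) zero    = a
punchSwap {suc n} (suc a) (suc b) = suc (punchSwap a b)

punchIn-punchSwap : (a : Fin (suc (suc n))) (b : Fin (suc n)) → punchIn (punchIn a b) (punchSwap a b) ≡ a
punchIn-punchSwap zero    b       = refl
punchIn-punchSwap (suc a) zero    = refl
punchIn-punchSwap {suc n} (suc a) (suc b) = cong suc (punchIn-punchSwap a b)

punchIn-punchIn-punchSwap : (a : Fin (suc (suc n))) (b : Fin (suc n)) (c : Fin n) →
  punchIn a (punchIn b c) ≡ punchIn (punchIn a b) (punchIn (punchSwap a b) c)
punchIn-punchIn-punchSwap zero    b       c       = refl
punchIn-punchIn-punchSwap (suc a) zero    c       = refl
punchIn-punchIn-punchSwap {suc n} (suc a) (suc b) zero    = refl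
punchIn-punchIn-punchSwap {suc n} (suc a) (suc b) (suc c) = cong suc (punchIn-punchIn-punchSwap a b c)

sign-punchSwap : (a : Fin (suc (suc n))) (b : Fin (suc n)) →
  sign a * sign b ≡ - (sign (punchIn a b) * sign (punchSwap a b))
sign-punchSwap zero b rewrite sign-suc (toℕ b) = lemma (sign b)
  where
  lemma : ∀ x → 1ℤ * x ≡ - (- x * 1ℤ)
  lemma = solve-∀
sign-punchSwap (suc a) zero rewrite sign-suc (toℕ a) = lemma (sign a)
  where
  lemma : ∀ x → - x * 1ℤ ≡ - (1ℤ * x)
  lemma = solve-∀
sign-punchSwap {suc n} (suc a) (suc b)
  rewrite sign-suc (toℕ a) | sign-suc (toℕ b)
        | sign-suc (toℕ (punchIn a b)) | sign-suc (toℕ (punchSwap a b)) =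
  trans (neg*neg (sign a) (sign b))
        (trans (sign-punchSwap a b) (cong -_ (sym (neg*neg (sign (punchIn a b)) (sign (punchSwap a b))))))
  where
  neg*neg : ∀ x y → - x * - y ≡ x * y
  neg*neg = solve-∀

-- Expanding det M twice along the first row gives Σ_a Σ_b M₀ₐ M₁_b (pairing D a b), where D a b
-- is the minor of rows ≥ 2 without the columns a and punchIn a b; pairing is antisymmetric
-- because the Laplace signs flip when the two columns are exchanged.
module _ (D : Fin (suc (suc n)) → Fin (suc n) → ℤ) where

  pairing : Fin (suc (suc n)) → Fin (suc (suc n)) → ℤ
  pairing a b with a ≟ b
  ... | yes _   = 0ℤ
  ... | no a≢b = sign a * sign (punchOut a≢b) * D a (punchOut a≢b)

  pairing-diag : ∀ a → pairing a a ≡ 0ℤ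
  pairing-diag a with a ≟ a
  ... | yes _   = refl
  ... | no a≢a = contradiction refl a≢a

  pairing-punchIn : ∀ a b → pairing a (punchIn a b) ≡ sign a * sign b * D a b
  pairing-punchIn a b with a ≟ punchIn a b
  ... | yes a≡ = contradiction (sym a≡) (punchInᵢ≢i a b)
  ... | no a≢  = cong (λ b′ → sign a * sign b′ * D a b′)
                      (trans (punchOut-cong a refl) (punchOut-punchIn a))

  pairing-antisym : (∀ a b → D a b ≡ D (punchIn a b) (punchSwap a b)) →
    ∀ a b → pairing a b ≡ - pairing b a
  pairing-antisym D-swap a b = by-cases (a ≟ b)
    where
    at-punchIn : ∀ b → pairing a (punchIn a b) ≡ - pairing (punchIn a b) a
    at-punchIn b = begin
      pairing a (punchIn a b)          ≡⟨ pairing-punchIn a b ⟩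
      sign a * sign b * D a b          ≡⟨ cong₂ _*_ (sign-punchSwap a b) (D-swap a b) ⟩
      - (sign a′ * sign b′) * D a′ b′  ≡⟨ neg-* (sign a′ * sign b′) (D a′ b′) ⟩
      - (sign a′ * sign b′ * D a′ b′)  ≡⟨ cong -_ (pairing-punchIn a′ b′) ⟨
      - pairing a′ (punchIn a′ b′)     ≡⟨ cong (λ c → - pairing a′ c) (punchIn-punchSwap a b) ⟩
      - pairing (punchIn a b) a        ∎
      where
      open ≡-Reasoning
      a′ = punchIn a b
      b′ = punchSwap a b
      neg-* : ∀ x y → - x * y ≡ - (x * y)
      neg-* = solve-∀
    by-cases : Dec (a ≡ b) → pairing a b ≡ - pairing b a
    by-cases (yes refl) = trans (pairing-diag a) (cong -_ (sym (pairing-diag a)))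
    by-cases (no a≢b)   =
      subst (λ b → pairing a b ≡ - pairing b a) (punchIn-punchOut a≢b) (at-punchIn (punchOut a≢b))

Alternating : ℕ → Set
Alternating n = ∀ (M : Matrix n) i j → i ≢ j → M i ≗ M j → det M ≡ 0ℤ

det-rows01-equal : (M : Matrix (suc (suc n))) → M zero ≗ M (suc zero) → det M ≡ 0ℤ
det-rows01-equal M r≗M₁ =
  trans (sumF-cong expand) (quadratic-antisymmetric r (pairing D) (pairing-antisym D D-swap))
  where
  r = M zero
  D : Fin (suc (suc _)) → Fin (suc _) → ℤ
  D a b = det (minor (minor M a) b)
  D-swap : ∀ a b → D a b ≡ D (punchIn a b) (punchSwap a b)
  D-swap a b = det-cong (λ i c → cong (M (suc (suc i))) (punchIn-punchIn-punchSwap a b c))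
  pull-r : ∀ s r t → s * r * t ≡ r * (s * t)
  pull-r = solve-∀
  regroup : ∀ s t r d → s * (t * r * d) ≡ r * (s * t * d)
  regroup = solve-∀
  expand : ∀ a → sign a * r a * det (minor M a) ≡ r a * sumF (λ b → r b * pairing D a b)
  expand a = begin
    sign a * r a * det (minor M a)
      ≡⟨ cong (sign a * r a *_)
              (sumF-cong (λ b → cong (λ t → sign b * t * D a b) (sym (r≗M₁ (punchIn a b))))) ⟩
    sign a * r a * sumF (λ b → sign b * r (punchIn a b) * D a b)
      ≡⟨ pull-r (sign a) (r a) _ ⟩
    r a * (sign a * sumF (λ b → sign b * r (punchIn a b) * D a b))
      ≡⟨ cong (r a *_) (sumF-*ˡ (sign a) (λ b → sign b * r (punchIn a b) * D a b)) ⟨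
    r a * sumF (λ b → sign a * (sign b * r (punchIn a b) * D a b))
      ≡⟨ cong (r a *_) (sumF-cong (λ b → regroup (sign a) (sign b) (r (punchIn a b)) (D a b))) ⟩
    r a * sumF (λ b → r (punchIn a b) * (sign a * sign b * D a b))
      ≡⟨ cong (r a *_) (sumF-cong (λ b → cong (r (punchIn a b) *_) (pairing-punchIn D a b))) ⟨
    r a * sumF (λ b → r (punchIn a b) * pairing D a (punchIn a b))
      ≡⟨ cong (r a *_) (sumF-punchIn (λ b → r b * pairing D a b) a
                          (trans (cong (r a *_) (pairing-diag D a)) (*-zeroʳ (r a)))) ⟨
    r a * sumF (λ b → r b * pairing D a b) ∎
    where open ≡-Reasoning

det-rows-suc-equal : Alternating (suc n) → (M : Matrix (suc (suc n))) (i j : Fin (suc n)) →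
  i ≢ j → M (suc i) ≗ M (suc j) → det M ≡ 0ℤ
det-rows-suc-equal alt M i j i≢j Mᵢ≗Mⱼ = sumF-zero (λ a →
  trans (cong (sign a * M zero a *_) (alt (minor M a) i j i≢j (Mᵢ≗Mⱼ ∘ punchIn a)))
        (*-zeroʳ (sign a * M zero a)))

biadditive-alternating⇒antisymmetric : (Φ : Vector n → Vector n → ℤ) →
  (∀ u v w → Φ (λ i → u i + v i) w ≡ Φ u w + Φ v w) →
  (∀ u v w → Φ u (λ i → v i + w i) ≡ Φ u v + Φ u w) →
  (∀ w → Φ w w ≡ 0ℤ) →
  ∀ u v → Φ u v ≡ - Φ v u
biadditive-alternating⇒antisymmetric Φ +ˡ +ʳ Φww≡0 u v = begin
  Φ u v                  ≡⟨ cancel (Φ u v) (Φ v u) ⟩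
  Φ u v + Φ v u - Φ v u  ≡⟨ cong (λ t → t - Φ v u) sum≡0 ⟩
  0ℤ - Φ v u             ≡⟨ +-identityˡ (- Φ v u) ⟩
  - Φ v u                ∎
  where
  open ≡-Reasoning
  u+v = λ i → u i + v i
  cancel : ∀ x y → x ≡ x + y - y
  cancel = solve-∀
  expand : ∀ a b c d → a + b + (c + d) ≡ b + c + (a + d)
  expand = solve-∀
  sum≡0 : Φ u v + Φ v u ≡ 0ℤ
  sum≡0 = begin
    Φ u v + Φ v u                    ≡⟨ +-identityʳ _ ⟨
    Φ u v + Φ v u + 0ℤ               ≡⟨ cong₂ (λ x y → Φ u v + Φ v u + (x + y)) (Φww≡0 u) (Φww≡0 v) ⟨
    Φ u v + Φ v u + (Φ u u + Φ v v)  ≡⟨ expand (Φ u u) (Φ u v) (Φ v u) (Φ v v) ⟨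
    Φ u u + Φ u v + (Φ v u + Φ v v)  ≡⟨ cong₂ _+_ (+ʳ u u v) (+ʳ v u v) ⟨
    Φ u u+v + Φ v u+v                ≡⟨ +ˡ u v u+v ⟨
    Φ u+v u+v                        ≡⟨ Φww≡0 u+v ⟩
    0ℤ                               ∎

-- With rows 1 and l+2 as variables, the determinant is an alternating biadditive form by the
-- induction hypothesis, hence antisymmetric; exchanging them reduces to equal rows 0 and 1.
det-rows0-suc-suc-equal : Alternating (suc n) → (M : Matrix (suc (suc n))) (l : Fin n) →
  M zero ≗ M (suc (suc l)) → det M ≡ 0ℤ
det-rows0-suc-suc-equal alt M l M₀≗Mₗ = begin
  det M                   ≡⟨ det-cong (λ i → cong-app (restore i)) ⟨
  Φ (M one) (M L)         ≡⟨ ≗-cong (linear-in-2nd (M one)) (sym ∘ M₀≗Mₗ) ⟩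
  Φ (M one) (M zero)      ≡⟨ biadditive-alternating⇒antisymmetric Φ
                               (λ u v w → +-hom (linear-in-1st w) u v)
                               (λ u v w → +-hom (linear-in-2nd u) v w)
                               Φww≡0 (M one) (M zero) ⟩
  - Φ (M zero) (M one)    ≡⟨ cong -_ (det-rows01-equal (M [ one ]≔ M zero [ L ]≔ M one) (λ _ → refl)) ⟩
  0ℤ                      ∎
  where
  open ≡-Reasoning
  one L : Fin (suc (suc _))
  one = suc zero
  L = suc (suc l)
  Φ : Vector (suc (suc _)) → Vector (suc (suc _)) → ℤ
  Φ u v = det (M [ one ]≔ u [ L ]≔ v)
  linear-in-2nd : ∀ u → IsLinear (λ v → Φ u v)
  linear-in-2nd u = det-linear (M [ one ]≔ u) L
  linear-in-1st : ∀ v → IsLinear (λ u → Φ u v)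
  linear-in-1st v = IsLinear-resp
    (λ u → det-cong (λ i → cong-app (updateAt-commutes L one {const v} {const u} (λ ()) M i)))
    (det-linear (M [ L ]≔ v) one)
  Φww≡0 : ∀ w → Φ w w ≡ 0ℤ
  Φww≡0 w = det-rows-suc-equal alt (M [ one ]≔ w [ L ]≔ w) zero (suc l) (λ ())
              (cong-app (sym (updateAt-updates L (M [ one ]≔ w))))
  restore : ∀ i → (M [ one ]≔ M one [ L ]≔ M L) i ≡ M i
  restore i = trans (updateAt-id-local L (M [ one ]≔ M one) refl i) (updateAt-id-local one M refl i)

det-alternating : ∀ n → Alternating n
det-alternating (suc n)       M zero          zero          i≢j _ = contradiction refl i≢j
det-alternating (suc (suc n)) M zero          (suc zero)    _   h = det-rows01-equal M h
det-alternating (suc (suc n)) M (suc zero)    zero          _   h = det-rows01-equal M (sym ∘ h)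
det-alternating (suc (suc n)) M zero          (suc (suc l)) _   h =
  det-rows0-suc-suc-equal (det-alternating (suc n)) M l h
det-alternating (suc (suc n)) M (suc (suc l)) zero          _   h =
  det-rows0-suc-suc-equal (det-alternating (suc n)) M l (sym ∘ h)
det-alternating (suc (suc n)) M (suc i)       (suc j)       i≢j h =
  det-rows-suc-equal (det-alternating (suc n)) M i j (i≢j ∘ cong suc) h

det-[]≔-transpose· : (M : Matrix n) (y : Vector n) (k : Fin n) →
  det (M [ k ]≔ (transpose M · y)) ≡ y k * det M
det-[]≔-transpose· {n} M y k = begin
  det (M [ k ]≔ (transpose M · y))
    ≡⟨ ≗-cong (det-linear M k) (λ c → sumF-cong (λ i → *-comm (M i c) (y i))) ⟩
  det (M [ k ]≔ (λ c → sumF (λ i → y i * M i c)))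
    ≡⟨ linear-sum (det-linear M k) M y ⟩
  sumF (λ i → y i * det (M [ k ]≔ M i))
    ≡⟨ sumF-single (λ i → y i * det (M [ k ]≔ M i)) k other-rows-vanish ⟩
  y k * det (M [ k ]≔ M k)
    ≡⟨ cong (y k *_) (det-cong (λ i → cong-app (updateAt-id-local k M refl i))) ⟩
  y k * det M ∎
  where
  open ≡-Reasoning
  other-rows-vanish : ∀ i → i ≢ k → y i * det (M [ k ]≔ M i) ≡ 0ℤ
  other-rows-vanish i i≢k = trans
    (cong (y i *_) (det-alternating n (M [ k ]≔ M i) k i (i≢k ∘ sym)
      (cong-app (trans (updateAt-updates k M) (sym (updateAt-minimal i k M i≢k))))))
    (*-zeroʳ (y i))

·-sub-scale : (M : Matrix n) (u v : Vector n) (a : ℤ) →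
  ∀ i → (M · (λ j → u j - a * v j)) i ≡ (M · u) i - a * (M · v) i
·-sub-scale M u v a i = begin
  sumF (λ j → M i j * (u j - a * v j))
    ≡⟨ sumF-cong (λ j → distrib (M i j) (u j) a (v j)) ⟩
  sumF (λ j → M i j * u j + (- a) * (M i j * v j))
    ≡⟨ sumF-+ (λ j → M i j * u j) (λ j → (- a) * (M i j * v j)) ⟩
  (M · u) i + sumF (λ j → (- a) * (M i j * v j))
    ≡⟨ cong (_+_ ((M · u) i)) (sumF-*ˡ (- a) (λ j → M i j * v j)) ⟩
  (M · u) i + (- a) * (M · v) i
    ≡⟨ neg-pull a ((M · u) i) ((M · v) i) ⟩
  (M · u) i - a * (M · v) i ∎
  where
  open ≡-Reasoning
  distrib : ∀ m u a v → m * (u - a * v) ≡ m * u + (- a) * (m * v)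
  distrib = solve-∀
  neg-pull : ∀ a x y → x + (- a) * y ≡ x - a * y
  neg-pull = solve-∀

∣⇒%ℕ≡0 : ∀ a p .{{_ : ℕ.NonZero p}} → + p ∣ a → a %ℕ p ≡ 0
∣⇒%ℕ≡0 (+ n)    p p∣a = ℕ.n∣m⇒m%n≡0 n p p∣a
∣⇒%ℕ≡0 -[1+ n ] p p∣a with suc n ℕ.% p | ℕ.n∣m⇒m%n≡0 (suc n) p p∣a
... | zero | _ = refl

∣⇒/ℕ*≡ : ∀ a p .{{_ : ℕ.NonZero p}} → + p ∣ a → a ≡ (a /ℕ p) * + p
∣⇒/ℕ*≡ a p p∣a = begin
  a                              ≡⟨ a≡a%ℕn+[a/ℕn]*n a p ⟩
  + (a %ℕ p) + (a /ℕ p) * + p    ≡⟨ cong (λ r → + r + (a /ℕ p) * + p) (∣⇒%ℕ≡0 a p p∣a) ⟩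
  0ℤ + (a /ℕ p) * + p            ≡⟨ +-identityˡ _ ⟩
  (a /ℕ p) * + p                 ∎
  where open ≡-Reasoning

+p^2≡+p*+p : ∀ p → + (p ^ 2) ≡ + p * + p
+p^2≡+p*+p p = trans (cong (λ q → + (p ℕ.* q)) (ℕ.*-identityʳ p)) (pos-* p p)

p²∣a-p*b : ∀ p .{{_ : ℕ.NonZero p}} a b → + p ∣ a → + p ∣ b - a /ℕ p →
  + (p ^ 2) Signed.∣ a - + p * b
p²∣a-p*b p a b p∣a p∣b-a/p with Signed.∣ᵤ⇒∣ p∣b-a/p
... | Signed.divides t b-a/p≡tp = Signed.divides (- t) (begin
  a - P * b                   ≡⟨ cong (λ x → x - P * b) (∣⇒/ℕ*≡ a p p∣a) ⟩
  a /ℕ p * P - P * b          ≡⟨ factor (a /ℕ p) b P ⟩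
  - (b - a /ℕ p) * P          ≡⟨ cong (λ x → - x * P) {b - a /ℕ p} b-a/p≡tp ⟩
  - (t * P) * P               ≡⟨ regroup t P ⟩
  - t * (P * P)               ≡⟨ cong (- t *_) (+p^2≡+p*+p p) ⟨
  - t * + (p ^ 2)             ∎)
  where
  open ≡-Reasoning
  P = + p
  factor : ∀ q b P → q * P - P * b ≡ - (b - q) * P
  factor = solve-∀
  regroup : ∀ t P → - (t * P) * P ≡ - t * (P * P)
  regroup = solve-∀

prime∤m⇒∣m*n⇒∣n : ∀ {p m n} → Prime p → ¬ p ℕ.∣ m → p ℕ.∣ m ℕ.* n → p ℕ.∣ n
prime∤m⇒∣m*n⇒∣n {m = m} {n} pp p∤m p∣mn with euclidsLemma m n pp p∣mn
... | inj₁ p∣m = contradiction p∣m p∤m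
... | inj₂ p∣n = p∣n

prime∤m⇒p*p∣m*n⇒p*p∣n : ∀ {p m n} → Prime p → ¬ p ℕ.∣ m →
  p ℕ.* p ℕ.∣ m ℕ.* n → p ℕ.* p ℕ.∣ n
prime∤m⇒p*p∣m*n⇒p*p∣n {p} {m} pp p∤m pp∣mn
  with prime∤m⇒∣m*n⇒∣n pp p∤m (ℕ.∣-trans (ℕ.m∣m*n p) pp∣mn)
... | ℕ.divides-refl k = ℕ.*-monoˡ-∣ p (prime∤m⇒∣m*n⇒∣n pp p∤m (ℕ.*-cancelʳ-∣ p pp∣mk*p))
  where
  instance _ = prime⇒nonZero pp
  pp∣mk*p : p ℕ.* p ℕ.∣ m ℕ.* k ℕ.* p
  pp∣mk*p = subst (p ℕ.* p ℕ.∣_) (sym (ℕ.*-assoc m k p)) pp∣mn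

prime∤m⇒p²∣m*n⇒p²∣n : ∀ {p m n} → Prime p → ¬ + p ∣ m → + (p ^ 2) ∣ m * n → + (p ^ 2) ∣ n
prime∤m⇒p²∣m*n⇒p²∣n {p} {m} {n} pp p∤m p²∣mn =
  subst (ℕ._∣ ∣ n ∣) (sym p^2≡p*p)
        (prime∤m⇒p*p∣m*n⇒p*p∣n pp p∤m (subst₂ ℕ._∣_ p^2≡p*p (abs-* m n) p²∣mn))
  where
  p^2≡p*p : p ^ 2 ≡ p ℕ.* p
  p^2≡p*p = cong (p ℕ.*_) (ℕ.*-identityʳ p)

∤⇒∤-sub-multiple : ∀ {p a} b → ¬ + p ∣ a → ¬ + p ∣ a - + p * b
∤⇒∤-sub-multiple {p} {a} b p∤a p∣a-pb = p∤a (Signed.∣⇒∣ᵤ (Signed.∣m+n∣n⇒∣m {+ p} {a}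
  (Signed.∣ᵤ⇒∣ {+ p} {a - + p * b} p∣a-pb) (Signed.∣m⇒∣-m (Signed.∣m⇒∣m*n b Signed.∣-refl))))

square-divides-det : (W : Matrix n) {p : ℕ} (pp : Prime p) (z x : Vector n) →
  (transpose W · z) ≡ᵥ zeroVec [mod p ] →
  ¬ (z ≡ᵥ zeroVec [mod p ]) →
  (transpose W · x) ≡ᵥ vecDivByPrime pp (transpose W · z) [mod p ] →
  + (p ^ 2) ∣ det W
square-divides-det {n} W {p} pp z x Wᵀz≡0 z≢0 Wᵀx≡Wᵀz/p =
  prime∤m⇒p²∣m*n⇒p²∣n {p} {y k} {det W} pp p∤yₖ
    (Signed.∣⇒∣ᵤ (Signed.divides (det (W [ k ]≔ u)) yₖdetW≡))
  where
  instance _ = prime⇒nonZero pp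
  P = + p
  p∤zₖ : Σ (Fin n) (λ k → ¬ P ∣ z k - 0ℤ)
  p∤zₖ = ¬∀⟶∃¬ n (λ i → P ∣ z i - 0ℤ) (λ i → p ℕ.∣? ∣ z i - 0ℤ ∣) z≢0
  k = proj₁ p∤zₖ
  y : Vector n
  y i = z i - P * x i
  p∤yₖ : ¬ P ∣ y k
  p∤yₖ = ∤⇒∤-sub-multiple {p} {z k} (x k) (proj₂ p∤zₖ ∘ subst (P ∣_) (sym (+-identityʳ (z k))))
  p²∣Wᵀy : ∀ c → + (p ^ 2) Signed.∣ (transpose W · y) c
  p²∣Wᵀy c = subst (+ (p ^ 2) Signed.∣_) (sym (·-sub-scale (transpose W) z x P c))
    (p²∣a-p*b p ((transpose W · z) c) ((transpose W · x) c)
      (subst (P ∣_) (+-identityʳ ((transpose W · z) c)) (Wᵀz≡0 c)) (Wᵀx≡Wᵀz/p c))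
  u : Vector n
  u c = Signed.quotient (p²∣Wᵀy c)
  yₖdetW≡ : y k * det W ≡ det (W [ k ]≔ u) * + (p ^ 2)
  yₖdetW≡ = begin
    y k * det W
      ≡⟨ det-[]≔-transpose· W y k ⟨
    det (W [ k ]≔ (transpose W · y))
      ≡⟨ ≗-cong (det-linear W k) (λ c → trans (Signed._∣_.equality (p²∣Wᵀy c)) (*-comm (u c) _)) ⟩
    det (W [ k ]≔ (λ c → + (p ^ 2) * u c))
      ≡⟨ *-hom (det-linear W k) (+ (p ^ 2)) u ⟩
    + (p ^ 2) * det (W [ k ]≔ u)
      ≡⟨ *-comm (+ (p ^ 2)) _ ⟩
    det (W [ k ]≔ u) * + (p ^ 2) ∎
    where open ≡-Reasoning

corollary1 : ∀ (n : ℕ) (G : SimpleGraph n) (p : ℕ) (pp : Prime p) →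
    RankMod p (walkMatrix G) (n ∸ 1) →
    (z : Vector n) →
    (transpose (walkMatrix G) · z) ≡ᵥ zeroVec [mod p ] →
    ¬ (z ≡ᵥ zeroVec [mod p ]) →
    Σ (Vector n) (λ x →
      (transpose (walkMatrix G) · x) ≡ᵥ vecDivByPrime pp (transpose (walkMatrix G) · z) [mod p ]) →
    (+ (p ^ 2)) ∣ det (walkMatrix G)
corollary1 n G p pp _ z Wᵀz≡0 z≢0 (x , Wᵀx≡Wᵀz/p) =
  square-divides-det (walkMatrix G) pp z x Wᵀz≡0 z≢0 Wᵀx≡Wᵀz/p
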